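{- Let $\{X_m\}_{m\in\mathbb{Z}}$ be a sequence of complex numbers, let $x,y$ be non-vanishing complex numbers (not depending on $m$), and let $\alpha,\beta$ be integers such that \[ X_m = xX_{m-\alpha}+yX_{m-\beta}\quad\text{for all } m\in\mathbb{Z}. \] Then for every integer $m$ and every non-negative integer $k$: \[ \sum_{j=0}^k \binom kj\left(\frac{x}{y}\right)^j X_{m-k\beta+(\beta-\alpha)j} = \frac{X_m}{y^k}, \] \[ \sum_{j=0}^k \binom kj\frac{X_{m+(\alpha-\beta)k+\beta j}}{(-y)^j} = \left(-\frac{x}{y}\right)^k X_m, \] \[ \sum_{j=0}^k \binom kj\frac{X_{m+(\beta-\alpha)k+\alpha j}}{(-x)^j} = \left(-\frac{y}{x}\right)^k X_m. \] -}

module Defs where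

open import Level using (Level)
open import Data.Nat using (ℕ; zero; suc)
open import Algebra.Bundles using (CommutativeRing; Semiring)
import Algebra.Definitions.RawSemiring as RS

module RingNotation {c ℓ : Level} (R : CommutativeRing c ℓ) where
  open CommutativeRing R

  open RS (Semiring.rawSemiring semiring) public
    using (_^_) renaming (_×_ to _·ℕ_)

  sumUpTo : ℕ → (ℕ → Carrier) → Carrier
  sumUpTo zero    f = f 0
  sumUpTo (suc k) f = sumUpTo k f + f (suc k)

{-# OPTIONS --safe #-}
module Submission where

open import Defs
open import Level using (Level)
open import Data.Nat using (ℕ; zero; suc)
open import Data.Nat.Properties using (n<1+n)
open import Data.Nat.Combinatorics using (_C_; nCk+nC[k+1]≡[n+1]C[k+1]; k>n⇒nCk≡0)
open import Data.Integer using (ℤ) renaming (_+_ to _+ℤ_; _-_ to _-ℤ_; _*_ to _*ℤ_; +_ to ⁺_; -_ to -ℤ_)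
import Data.Integer.Properties as ℤ
open import Data.Integer.Tactic.RingSolver using (solve-∀)
open import Data.Product using (_×_; _,_)
open import Algebra.Bundles using (CommutativeRing)
import Algebra.Properties.AbelianGroup as AbelianGroupProperties
import Algebra.Properties.CommutativeSemigroup as CommutativeSemigroupProperties
import Algebra.Properties.Ring as RingProperties
import Algebra.Properties.Semiring.Mult as MultProperties
import Relation.Binary.PropositionalEquality as ≡
import Relation.Binary.Reasoning.Setoid as SetoidReasoning

-- If c·X_n = X_{n+p} + a·X_{n+q} for every n, then applying this relation k times
-- expands c^k·X_n, exactly as (E_p + a E_q)^k expands by the binomial theorem for the
-- commuting shifts E_p, E_q. Dividing the recurrence by y gives such a relation with
-- c = 1/y, a = x/y, p = -β, q = -α (first identity); solving the recurrence at n + α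
-- for X_n gives one with c = -x/y, a = -1/y, p = α - β, q = α (second identity);
-- the third identity is the second with the roles of (x, α) and (y, β) exchanged.

module _ {r ℓ : Level} (R : CommutativeRing r ℓ) where
  open CommutativeRing R hiding (zero)
  open RingNotation R
  open MultProperties semiring using (×-congˡ; ×-congʳ; ×-homo-0; ×-homo-1; ×-homo-+; ×-comm-*)
  open RingProperties ring using (-‿distribˡ-*)
  open AbelianGroupProperties +-abelianGroup using (xyx⁻¹≈y; ⁻¹-anti-homo‿-)
  open CommutativeSemigroupProperties *-commutativeSemigroup using (x∙yz≈y∙xz; x∙yz≈yx∙z; xy∙z≈y∙xz)
  open CommutativeSemigroupProperties +-commutativeSemigroup using (interchange; x∙yz≈xz∙y)
  open SetoidReasoning setoid

  sumUpTo-cong : ∀ k {f g : ℕ → Carrier} → (∀ j → f j ≈ g j) → sumUpTo k f ≈ sumUpTo k g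
  sumUpTo-cong zero    f≈g = f≈g 0
  sumUpTo-cong (suc k) f≈g = +-cong (sumUpTo-cong k f≈g) (f≈g (suc k))

  sumUpTo-distrib-+ : ∀ k (f g : ℕ → Carrier) →
                      sumUpTo k (λ j → f j + g j) ≈ sumUpTo k f + sumUpTo k g
  sumUpTo-distrib-+ zero    f g = refl
  sumUpTo-distrib-+ (suc k) f g = trans (+-congʳ (sumUpTo-distrib-+ k f g)) (interchange _ _ _ _)

  *-distribˡ-sumUpTo : ∀ k a (f : ℕ → Carrier) → a * sumUpTo k f ≈ sumUpTo k (λ j → a * f j)
  *-distribˡ-sumUpTo zero    a f = refl
  *-distribˡ-sumUpTo (suc k) a f = trans (distribˡ a _ _) (+-congʳ (*-distribˡ-sumUpTo k a f))

  sumUpTo-suc : ∀ k (f : ℕ → Carrier) → sumUpTo (suc k) f ≈ f 0 + sumUpTo k (λ j → f (suc j))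
  sumUpTo-suc zero    f = refl
  sumUpTo-suc (suc k) f = trans (+-congʳ (sumUpTo-suc k f)) (+-assoc _ _ _)

  binomialSum : ℕ → (ℕ → Carrier) → Carrier
  binomialSum k g = sumUpTo k (λ j → (k C j) ·ℕ g j)

  binomialSum-cong : ∀ k {f g : ℕ → Carrier} → (∀ j → f j ≈ g j) → binomialSum k f ≈ binomialSum k g
  binomialSum-cong k f≈g = sumUpTo-cong k (λ j → ×-congʳ (k C j) (f≈g j))

  *-distribˡ-binomialSum : ∀ k a (g : ℕ → Carrier) →
                           a * binomialSum k g ≈ binomialSum k (λ j → a * g j)
  *-distribˡ-binomialSum k a g =
    trans (*-distribˡ-sumUpTo k a _) (sumUpTo-cong k (λ j → ×-comm-* (k C j) a (g j)))

  binomialSum-pascal : ∀ k (g : ℕ → Carrier) →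
                       binomialSum (suc k) g ≈ binomialSum k g + binomialSum k (λ j → g (suc j))
  binomialSum-pascal k g = begin
    binomialSum (suc k) g
      ≈⟨ sumUpTo-suc k _ ⟩
    g′ 0 + sumUpTo k (λ j → (suc k C suc j) ·ℕ g (suc j))
      ≈⟨ +-congˡ (sumUpTo-cong k pascal) ⟩
    g′ 0 + sumUpTo k (λ j → (k C j) ·ℕ g (suc j) + (k C suc j) ·ℕ g (suc j))
      ≈⟨ +-congˡ (sumUpTo-distrib-+ k _ _) ⟩
    g′ 0 + (binomialSum k (λ j → g (suc j)) + sumUpTo k (λ j → g′ (suc j)))
      ≈⟨ x∙yz≈xz∙y _ _ _ ⟩
    (g′ 0 + sumUpTo k (λ j → g′ (suc j))) + binomialSum k (λ j → g (suc j))
      ≈⟨ +-congʳ (sym (sumUpTo-suc k g′)) ⟩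
    (binomialSum k g + g′ (suc k)) + binomialSum k (λ j → g (suc j))
      ≈⟨ +-congʳ (trans (+-congˡ top-vanishes) (+-identityʳ _)) ⟩
    binomialSum k g + binomialSum k (λ j → g (suc j)) ∎
    where
    g′ : ℕ → Carrier
    g′ j = (k C j) ·ℕ g j

    pascal : ∀ j → (suc k C suc j) ·ℕ g (suc j) ≈ (k C j) ·ℕ g (suc j) + (k C suc j) ·ℕ g (suc j)
    pascal j = trans (×-congˡ (≡.sym (nCk+nC[k+1]≡[n+1]C[k+1] k j))) (×-homo-+ _ (k C j) (k C suc j))

    top-vanishes : g′ (suc k) ≈ 0#
    top-vanishes = trans (×-congˡ (k>n⇒nCk≡0 (n<1+n k))) (×-homo-0 (g (suc k)))

  X-cong : (X : ℤ → Carrier) {i j : ℤ} → i ≡.≡ j → X i ≈ X j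
  X-cong X i≡j = reflexive (≡.cong X i≡j)

  ShiftRelation : Carrier → Carrier → ℤ → ℤ → (ℤ → Carrier) → Set ℓ
  ShiftRelation c a p q X = ∀ n → c * X n ≈ X (n +ℤ p) + a * X (n +ℤ q)

  shiftRelation⇒binomialExpansion :
    ∀ {c a p q X} → ShiftRelation c a p q X →
    ∀ k n → c ^ k * X n ≈ binomialSum k (λ j → a ^ j * X (n +ℤ p *ℤ ⁺ k +ℤ (q -ℤ p) *ℤ ⁺ j))
  shiftRelation⇒binomialExpansion {a = a} {p} {q} {X} _ zero n = begin
    1# * X n
      ≈⟨ *-congˡ (X-cong X (index₀ n p q)) ⟩
    1# * X (n +ℤ p *ℤ ⁺ 0 +ℤ (q -ℤ p) *ℤ ⁺ 0)
      ≈⟨ ×-homo-1 _ ⟨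
    binomialSum 0 (λ j → a ^ j * X (n +ℤ p *ℤ ⁺ 0 +ℤ (q -ℤ p) *ℤ ⁺ j)) ∎
    where
    index₀ : ∀ n p q → n ≡.≡ n +ℤ p *ℤ ⁺ 0 +ℤ (q -ℤ p) *ℤ ⁺ 0
    index₀ = solve-∀
  shiftRelation⇒binomialExpansion {c} {a} {p} {q} {X} rel (suc k) n = begin
    (c * c ^ k) * X n                           ≈⟨ xy∙z≈y∙xz _ _ _ ⟩
    c ^ k * (c * X n)                           ≈⟨ *-congˡ (rel n) ⟩
    c ^ k * (X (n +ℤ p) + a * X (n +ℤ q))       ≈⟨ distribˡ _ _ _ ⟩
    c ^ k * X (n +ℤ p) + c ^ k * (a * X (n +ℤ q)) ≈⟨ +-congˡ (x∙yz≈y∙xz _ _ _) ⟩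
    c ^ k * X (n +ℤ p) + a * (c ^ k * X (n +ℤ q))
      ≈⟨ +-cong (expand (n +ℤ p)) (*-congˡ (expand (n +ℤ q))) ⟩
    binomialSum k (λ j → a ^ j * X (n +ℤ p +ℤ p *ℤ ⁺ k +ℤ (q -ℤ p) *ℤ ⁺ j))
      + a * binomialSum k (λ j → a ^ j * X (n +ℤ q +ℤ p *ℤ ⁺ k +ℤ (q -ℤ p) *ℤ ⁺ j))
      ≈⟨ +-congˡ (*-distribˡ-binomialSum k a _) ⟩
    binomialSum k (λ j → a ^ j * X (n +ℤ p +ℤ p *ℤ ⁺ k +ℤ (q -ℤ p) *ℤ ⁺ j))
      + binomialSum k (λ j → a * (a ^ j * X (n +ℤ q +ℤ p *ℤ ⁺ k +ℤ (q -ℤ p) *ℤ ⁺ j)))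
      ≈⟨ +-cong (binomialSum-cong k λ j → *-congˡ (X-cong X (index-p n p q (⁺ k) (⁺ j))))
                (binomialSum-cong k λ j → trans (sym (*-assoc _ _ _))
                                                (*-congˡ (X-cong X (index-q n p q (⁺ k) (⁺ j))))) ⟩
    binomialSum k G + binomialSum k (λ j → G (suc j)) ≈⟨ binomialSum-pascal k G ⟨
    binomialSum (suc k) G ∎
    where
    expand : ∀ n → c ^ k * X n ≈ binomialSum k (λ j → a ^ j * X (n +ℤ p *ℤ ⁺ k +ℤ (q -ℤ p) *ℤ ⁺ j))
    expand = shiftRelation⇒binomialExpansion rel k

    G : ℕ → Carrier
    G j = a ^ j * X (n +ℤ p *ℤ ⁺ suc k +ℤ (q -ℤ p) *ℤ ⁺ j)

    index-p : ∀ n p q K J → n +ℤ p +ℤ p *ℤ K +ℤ (q -ℤ p) *ℤ J ≡.≡ n +ℤ p *ℤ (⁺ 1 +ℤ K) +ℤ (q -ℤ p) *ℤ J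
    index-p = solve-∀

    index-q : ∀ n p q K J →
              n +ℤ q +ℤ p *ℤ K +ℤ (q -ℤ p) *ℤ J ≡.≡ n +ℤ p *ℤ (⁺ 1 +ℤ K) +ℤ (q -ℤ p) *ℤ (⁺ 1 +ℤ J)
    index-q = solve-∀

  x≈y+z⇒-z≈y-x : ∀ {x y z} → x ≈ y + z → - z ≈ y - x
  x≈y+z⇒-z≈y-x {x} {y} {z} x≈y+z = begin
    - z         ≈⟨ -‿cong (trans (sym (xyx⁻¹≈y y z)) (+-congʳ (sym x≈y+z))) ⟩
    - (x - y)   ≈⟨ ⁻¹-anti-homo‿- x y ⟩
    y - x       ∎

  module _ (X : ℤ → Carrier) (x y y⁻¹ : Carrier) (y*y⁻¹≈1 : y * y⁻¹ ≈ 1#) (α β : ℤ)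
           (recurrence : ∀ m → X m ≈ x * X (m -ℤ α) + y * X (m -ℤ β)) where

    recurrence⇒descendingShiftRelation : ShiftRelation y⁻¹ (x * y⁻¹) (-ℤ β) (-ℤ α) X
    recurrence⇒descendingShiftRelation n = begin
      y⁻¹ * X n                                        ≈⟨ *-congˡ (recurrence n) ⟩
      y⁻¹ * (x * X (n -ℤ α) + y * X (n -ℤ β))          ≈⟨ distribˡ _ _ _ ⟩
      y⁻¹ * (x * X (n -ℤ α)) + y⁻¹ * (y * X (n -ℤ β))  ≈⟨ +-cong (x∙yz≈yx∙z _ _ _) y⁻¹-cancels ⟩
      (x * y⁻¹) * X (n -ℤ α) + X (n -ℤ β)              ≈⟨ +-comm _ _ ⟩
      X (n -ℤ β) + (x * y⁻¹) * X (n -ℤ α)              ∎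
      where
      y⁻¹-cancels : y⁻¹ * (y * X (n -ℤ β)) ≈ X (n -ℤ β)
      y⁻¹-cancels = trans (x∙yz≈yx∙z _ _ _) (trans (*-congʳ y*y⁻¹≈1) (*-identityˡ _))

    recurrence⇒ascendingShiftRelation : ShiftRelation (- (x * y⁻¹)) (- y⁻¹) (α -ℤ β) α X
    recurrence⇒ascendingShiftRelation n = begin
      - (x * y⁻¹) * X n                          ≈⟨ -‿distribˡ-* _ _ ⟨
      - ((x * y⁻¹) * X n)                        ≈⟨ x≈y+z⇒-z≈y-x descending-at-n+α ⟩
      X (n +ℤ (α -ℤ β)) - y⁻¹ * X (n +ℤ α)       ≈⟨ +-congˡ (-‿distribˡ-* _ _) ⟩
      X (n +ℤ (α -ℤ β)) + - y⁻¹ * X (n +ℤ α)     ∎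
      where
      i+j-j≡i : ∀ i j → i +ℤ j -ℤ j ≡.≡ i
      i+j-j≡i = solve-∀

      descending-at-n+α : y⁻¹ * X (n +ℤ α) ≈ X (n +ℤ (α -ℤ β)) + (x * y⁻¹) * X n
      descending-at-n+α = trans (recurrence⇒descendingShiftRelation (n +ℤ α))
        (+-cong (X-cong X (ℤ.+-assoc n α (-ℤ β))) (*-congˡ (X-cong X (i+j-j≡i n α))))

    descendingExpansion : ∀ m k →
      sumUpTo k (λ j → (k C j) ·ℕ ((x * y⁻¹) ^ j * X (m -ℤ ⁺ k *ℤ β +ℤ (β -ℤ α) *ℤ ⁺ j)))
        ≈ X m * y⁻¹ ^ k
    descendingExpansion m k = begin
      binomialSum k (λ j → (x * y⁻¹) ^ j * X (m -ℤ ⁺ k *ℤ β +ℤ (β -ℤ α) *ℤ ⁺ j))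
        ≈⟨ binomialSum-cong k (λ j → *-congˡ (X-cong X (index m α β (⁺ k) (⁺ j)))) ⟩
      binomialSum k (λ j → (x * y⁻¹) ^ j * X (m +ℤ -ℤ β *ℤ ⁺ k +ℤ (-ℤ α -ℤ -ℤ β) *ℤ ⁺ j))
        ≈⟨ shiftRelation⇒binomialExpansion recurrence⇒descendingShiftRelation k m ⟨
      y⁻¹ ^ k * X m
        ≈⟨ *-comm _ _ ⟩
      X m * y⁻¹ ^ k ∎
      where
      index : ∀ m α β K J → m -ℤ K *ℤ β +ℤ (β -ℤ α) *ℤ J ≡.≡ m +ℤ -ℤ β *ℤ K +ℤ (-ℤ α -ℤ -ℤ β) *ℤ J
      index = solve-∀

    ascendingExpansion : ∀ m k →
      sumUpTo k (λ j → (k C j) ·ℕ (X (m +ℤ (α -ℤ β) *ℤ ⁺ k +ℤ β *ℤ ⁺ j) * (- y⁻¹) ^ j))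
        ≈ (- (x * y⁻¹)) ^ k * X m
    ascendingExpansion m k = begin
      binomialSum k (λ j → X (m +ℤ (α -ℤ β) *ℤ ⁺ k +ℤ β *ℤ ⁺ j) * (- y⁻¹) ^ j)
        ≈⟨ binomialSum-cong k (λ j → trans (*-comm _ _) (*-congˡ (X-cong X (index m α β (⁺ k) (⁺ j))))) ⟩
      binomialSum k (λ j → (- y⁻¹) ^ j * X (m +ℤ (α -ℤ β) *ℤ ⁺ k +ℤ (α -ℤ (α -ℤ β)) *ℤ ⁺ j))
        ≈⟨ shiftRelation⇒binomialExpansion recurrence⇒ascendingShiftRelation k m ⟨
      (- (x * y⁻¹)) ^ k * X m ∎
      where
      index : ∀ m α β K J → m +ℤ (α -ℤ β) *ℤ K +ℤ β *ℤ J ≡.≡ m +ℤ (α -ℤ β) *ℤ K +ℤ (α -ℤ (α -ℤ β)) *ℤ J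
      index = solve-∀

lemma7 : {c ℓ : Level} (R : CommutativeRing c ℓ) →
         let open CommutativeRing R
             open RingNotation R
         in
         (X : ℤ → Carrier) (x y x⁻¹ y⁻¹ : Carrier) →
         x * x⁻¹ ≈ 1# → y * y⁻¹ ≈ 1# →
         (α β : ℤ) →
         (∀ m → X m ≈ x * X (m -ℤ α) + y * X (m -ℤ β)) →
         (m : ℤ) (k : ℕ) →
         (sumUpTo k (λ j → (k C j) ·ℕ ((x * y⁻¹) ^ j * X (m -ℤ (⁺ k) *ℤ β +ℤ (β -ℤ α) *ℤ (⁺ j))))
            ≈ X m * y⁻¹ ^ k)
         × (sumUpTo k (λ j → (k C j) ·ℕ (X (m +ℤ (α -ℤ β) *ℤ (⁺ k) +ℤ β *ℤ (⁺ j)) * (- y⁻¹) ^ j))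
            ≈ (- (x * y⁻¹)) ^ k * X m)
         × (sumUpTo k (λ j → (k C j) ·ℕ (X (m +ℤ (β -ℤ α) *ℤ (⁺ k) +ℤ α *ℤ (⁺ j)) * (- x⁻¹) ^ j))
            ≈ (- (y * x⁻¹)) ^ k * X m)
lemma7 R X x y x⁻¹ y⁻¹ x*x⁻¹≈1 y*y⁻¹≈1 α β recurrence m k =
  descendingExpansion R X x y y⁻¹ y*y⁻¹≈1 α β recurrence m k ,
  ascendingExpansion R X x y y⁻¹ y*y⁻¹≈1 α β recurrence m k ,
  ascendingExpansion R X y x x⁻¹ x*x⁻¹≈1 β α recurrence′ m k
  where
  open CommutativeRing R using (_≈_; _+_; _*_; trans; +-comm)

  recurrence′ : ∀ n → X n ≈ y * X (n -ℤ β) + x * X (n -ℤ α)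
  recurrence′ n = trans (recurrence n) (+-comm _ _)
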